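{- Let $R$ be a monotone transit function on a non-empty finite set $V$ satisfying (tb): for every $W\subseteq V$ with $|W|\ge3$ there exists $x\in W$ such that for all $u,v\in W$, $R(x,u)\subseteq R(x,v)$ or $R(x,v)\subseteq R(x,u)$. Then $R$ satisfies (tb2): for every non-empty $W\subseteq V$ there exist $x,y\in W$ such that $W\subseteq R(x,y)$.
   Context: A transit function on $V$ is a map $R:V\times V\to 2^V$ with $u\in R(u,v)$, $R(u,v)=R(v,u)$, $R(u,u)=\{u\}$ for all $u,v\in V$; it is monotone if $p,q\in R(u,v)$ implies $R(p,q)\subseteq R(u,v)$. -}

module Defs where

open import Data.Nat using (ℕ)
open import Data.Fin using (Fin)
open import Data.Fin.Subset using (Subset; _∈_; _⊆_; ∣_∣; Nonempty; ⁅_⁆)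
open import Data.Nat using (_≥_)
open import Data.Sum using (_⊎_)
open import Data.Product using (_×_; ∃-syntax)
open import Relation.Binary.PropositionalEquality using (_≡_)


record IsTransit {n : ℕ} (R : Fin n → Fin n → Subset n) : Set where
  field
    ext  : ∀ u v → u ∈ R u v
    symm : ∀ u v → R u v ≡ R v u
    idem : ∀ u → R u u ≡ ⁅ u ⁆

Monotone : {n : ℕ} → (Fin n → Fin n → Subset n) → Set
Monotone {n} R = ∀ u v p q → p ∈ R u v → q ∈ R u v → R p q ⊆ R u v

TB : {n : ℕ} → (Fin n → Fin n → Subset n) → Set
TB {n} R = ∀ (W : Subset n) → ∣ W ∣ ≥ 3 →
  ∃[ x ] (x ∈ W × (∀ u v → u ∈ W → v ∈ W → (R x u ⊆ R x v) ⊎ (R x v ⊆ R x u)))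

TB2 : {n : ℕ} → (Fin n → Fin n → Subset n) → Set
TB2 {n} R = ∀ (W : Subset n) → Nonempty W →
  ∃[ x ] ∃[ y ] (x ∈ W × y ∈ W × W ⊆ R x y)

{-# OPTIONS --safe #-}
-- Fix x ∈ W for which the intervals R(x,u), u ∈ W, form a chain under inclusion: by (tb)
-- when |W| ≥ 3, and any x ∈ W when |W| ≤ 2 (two incomparable R(x,u), R(x,v) would force
-- x, u, v to be distinct).  A finite chain has a largest member R(x,y), and every v ∈ W
-- lies in R(x,v) ⊆ R(x,y).
module Submission where

open import Defs
open import Data.Nat using (ℕ; suc; _<_; _≤_; s≤s; z≤n)
open import Data.Nat.Properties using (≤-trans; _≤?_)
open import Data.Fin using (Fin)
open import Data.Fin.Subset using (Subset; _∈_; _⊆_; ∣_∣; _-_)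
open import Data.Fin.Subset.Properties
  using (_∈?_; _⊆?_; ⊆-refl; ⊆-trans; x∈⁅y⁆⇒x≡y; x∈p∧x≢y⇒x∈p-y; x∈p⇒∣p-x∣<∣p∣)
open import Data.List using (List; []; _∷_; allFin)
open import Data.List.Membership.Propositional using () renaming (_∈_ to _∈ₗ_)
open import Data.List.Membership.Propositional.Properties using (∈-allFin)
open import Data.List.Relation.Unary.Any using (here; there)
open import Data.Sum using (_⊎_; inj₁; inj₂)
open import Data.Product using (_×_; _,_; ∃-syntax)
open import Relation.Nullary using (¬_; yes; no; contradiction)
open import Relation.Unary using (Pred; Decidable)
open import Relation.Binary using (Rel; Reflexive; Transitive)
open import Relation.Binary.PropositionalEquality using (_≢_; refl; subst)

module _ {a ℓ p} {A : Set a} (_≼_ : Rel A ℓ) (≼-refl : Reflexive _≼_) (≼-trans : Transitive _≼_)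
         {P : Pred A p} (P? : Decidable P) (total : ∀ {u v} → P u → P v → u ≼ v ⊎ v ≼ u) where

  maximum-in-list : ∀ {m₀} → P m₀ → (L : List A) → ∃[ m ] (P m × (∀ {v} → v ∈ₗ L → P v → v ≼ m))
  maximum-in-list Pm₀ [] = _ , Pm₀ , λ ()
  maximum-in-list Pm₀ (b ∷ L) with maximum-in-list Pm₀ L
  ... | m , Pm , below-m with P? b
  ...   | no ¬Pb = m , Pm , λ { (here refl) Pb → contradiction Pb ¬Pb ; (there v∈L) → below-m v∈L }
  ...   | yes Pb with total Pb Pm
  ...     | inj₁ b≼m = m , Pm , λ { (here refl) _ → b≼m ; (there v∈L) → below-m v∈L }
  ...     | inj₂ m≼b = b , Pb , λ { (here refl) _ → ≼-refl ; (there v∈L) Pv → ≼-trans (below-m v∈L Pv) m≼b }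

module _ {n ℓ p} (_≼_ : Rel (Fin n) ℓ) (≼-refl : Reflexive _≼_) (≼-trans : Transitive _≼_)
         {P : Pred (Fin n) p} (P? : Decidable P) (total : ∀ {u v} → P u → P v → u ≼ v ⊎ v ≼ u) where

  maximum-in-Fin : ∀ {m₀} → P m₀ → ∃[ m ] (P m × ∀ v → P v → v ≼ m)
  maximum-in-Fin Pm₀ with maximum-in-list _≼_ ≼-refl ≼-trans P? total Pm₀ (allFin n)
  ... | m , Pm , below-m = m , Pm , λ v → below-m (∈-allFin v)

three-distinct⇒3≤∣p∣ : ∀ {n} {p : Subset n} {x y z} → x ∈ p → y ∈ p → z ∈ p →
                       y ≢ x → z ≢ x → z ≢ y → 3 ≤ ∣ p ∣
three-distinct⇒3≤∣p∣ {p = p} {x} {y} x∈p y∈p z∈p y≢x z≢x z≢y =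
  ≤-trans (s≤s (s≤s ∣p-x-y∣>0)) (≤-trans (s≤s ∣p-x-y∣<∣p-x∣) ∣p-x∣<∣p∣)
  where
  ∣p-x-y∣>0 : 0 < ∣ p - x - y ∣
  ∣p-x-y∣>0 = ≤-trans (s≤s z≤n) (x∈p⇒∣p-x∣<∣p∣ (x∈p∧x≢y⇒x∈p-y (x∈p∧x≢y⇒x∈p-y z∈p z≢x) z≢y))
  ∣p-x-y∣<∣p-x∣ : ∣ p - x - y ∣ < ∣ p - x ∣
  ∣p-x-y∣<∣p-x∣ = x∈p⇒∣p-x∣<∣p∣ (x∈p∧x≢y⇒x∈p-y y∈p y≢x)
  ∣p-x∣<∣p∣ : ∣ p - x ∣ < ∣ p ∣
  ∣p-x∣<∣p∣ = x∈p⇒∣p-x∣<∣p∣ x∈p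

ChainAt : ∀ {n} → (Fin n → Fin n → Subset n) → Subset n → Fin n → Set
ChainAt R W x = ∀ u v → u ∈ W → v ∈ W → R x u ⊆ R x v ⊎ R x v ⊆ R x u

module _ {n} {R : Fin n → Fin n → Subset n} (transit : IsTransit R) where
  open IsTransit transit

  ∈-R-right : ∀ x v → v ∈ R x v
  ∈-R-right x v = subst (v ∈_) (symm v x) (ext v x)

  R-diag⊆R : ∀ x v → R x x ⊆ R x v
  R-diag⊆R x v u∈Rxx with x∈⁅y⁆⇒x≡y x (subst (_ ∈_) (idem x) u∈Rxx)
  ... | refl = ext x v

  chainAt-small : ∀ {W x} → ¬ 3 ≤ ∣ W ∣ → x ∈ W → ChainAt R W x
  chainAt-small {W} {x} 3≰∣W∣ x∈W u v u∈W v∈W with R x u ⊆? R x v | R x v ⊆? R x u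
  ... | yes u⊆v | _       = inj₁ u⊆v
  ... | no _    | yes v⊆u = inj₂ v⊆u
  ... | no u⊈v  | no v⊈u  = contradiction (three-distinct⇒3≤∣p∣ x∈W u∈W v∈W u≢x v≢x v≢u) 3≰∣W∣
    where
    u≢x : u ≢ x
    u≢x refl = u⊈v (R-diag⊆R u v)
    v≢x : v ≢ x
    v≢x refl = v⊈u (R-diag⊆R v u)
    v≢u : v ≢ u
    v≢u refl = u⊈v ⊆-refl

  chainAt⇒TB2-witness : ∀ {W x} → x ∈ W → ChainAt R W x → ∃[ x ] ∃[ y ] (x ∈ W × y ∈ W × W ⊆ R x y)
  chainAt⇒TB2-witness {W} {x} x∈W chain
    with maximum-in-Fin (λ u v → R x u ⊆ R x v) ⊆-refl ⊆-trans (_∈? W) (λ {u} {v} → chain u v) x∈W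
  ... | y , y∈W , below-y = x , y , x∈W , y∈W , λ {v} v∈W → below-y v v∈W (∈-R-right x v)

mainTheorem16 : (n : ℕ) (R : Fin (suc n) → Fin (suc n) → Subset (suc n)) →
                IsTransit R → Monotone R → TB R → TB2 R
mainTheorem16 n R transit _ tb W (a , a∈W) with 3 ≤? ∣ W ∣
... | yes 3≤∣W∣ = let x , x∈W , chain = tb W 3≤∣W∣ in chainAt⇒TB2-witness transit x∈W chain
... | no 3≰∣W∣  = chainAt⇒TB2-witness transit a∈W (chainAt-small transit 3≰∣W∣ a∈W)
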